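{- Let $\mathcal{C}$ be an elementary topos with subobject classifier $\mathtt{true}\colon \mathbf{1}\rightarrowtail\Omega$, let $\varphi\colon L\to A$ be an arrow of $\mathcal{C}$, and let $\mathtt{true}_A\colon A\rightarrowtail A\times\Omega$ be the subobject classifier of the slice category $\mathcal{C}\downarrow A$, viewed as an arrow from $\mathrm{id}_A\colon A\to A$ to the projection $\pi_1\colon A\times\Omega\to A$ (i.e. $\mathtt{true}_A=\langle \mathrm{id}_A,\mathtt{true}\circ !_A\rangle$). Let $L\xrightarrow{\eta_\phi}\overline{\phi}\xrightarrow{\chi_{\eta_\phi}}A\times\Omega$ be the final pullback complement of $L\xrightarrow{\varphi}A\xrightarrow{\mathtt{true}_A}A\times\Omega$. Then $\eta_\phi$ is a mono and $L\xrightarrow{\eta_\phi}\overline{\phi}\xrightarrow{\psi}A$ with $\psi=\pi_1\circ\chi_{\eta_\phi}$ is the terminal object of the materialization category $\mathrm{Mat}(\varphi)$.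
   Context: A pair of arrows $I\xrightarrow{\gamma}F\xrightarrow{\beta}G$ is a final pullback complement (FPBC) of a pair $I\xrightarrow{\alpha}L\xrightarrow{m}G$ if $m\circ\alpha=\beta\circ\gamma$ is a pullback square, and for every pullback square $G\xleftarrow{m}L\xleftarrow{\alpha'}I'\xrightarrow{\gamma'}F'\xrightarrow{\beta'}G$ and every arrow $f\colon I'\to I$ with $\alpha\circ f=\alpha'$ there is a unique $f'\colon F'\to F$ with $\beta\circ f'=\beta'$ and $\gamma\circ f=f'\circ\gamma'$. The materialization category $\mathrm{Mat}(\varphi)$ of $\varphi\colon L\to A$ has as objects all factorizations $L\xrightarrow{m}X\xrightarrow{\psi}A$ of $\varphi$ with $m$ mono; an arrow from $L\xrightarrow{m}X\xrightarrow{\psi}A$ to $L\xrightarrow{m'}Y\xrightarrow{\psi'}A$ is an arrow $f\colon X\to Y$ with $\psi'\circ f=\psi$ such that the square $f\circ m=m'\circ\mathrm{id}_L$ is a pullback. -}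

module Defs where

open import Level using (Level; _⊔_; suc)
open import Data.Product using (Σ; _×_; _,_; proj₁; proj₂)
open import Relation.Binary.PropositionalEquality using (_≡_)

record Category (o ℓ : Level) : Set (suc (o ⊔ ℓ)) where
  infixr 9 _∘_
  field
    Obj  : Set o
    Hom  : Obj → Obj → Set ℓ
    id   : ∀ {A} → Hom A A
    _∘_  : ∀ {A B C} → Hom B C → Hom A B → Hom A C
    assoc     : ∀ {A B C D} {f : Hom A B} {g : Hom B C} {h : Hom C D} →
                (h ∘ g) ∘ f ≡ h ∘ (g ∘ f)
    identityˡ : ∀ {A B} {f : Hom A B} → id ∘ f ≡ f
    identityʳ : ∀ {A B} {f : Hom A B} → f ∘ id ≡ f

module _ {o ℓ : Level} (C : Category o ℓ) where
  open Category C

  Mono : ∀ {A B} → Hom A B → Set (o ⊔ ℓ)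
  Mono {A} f = ∀ {X} (g h : Hom X A) → f ∘ g ≡ f ∘ h → g ≡ h

  IsPullback : ∀ {P X Y Z} (f : Hom X Z) (g : Hom Y Z) (p₁ : Hom P X) (p₂ : Hom P Y) →
               Set (o ⊔ ℓ)
  IsPullback {P} {X} {Y} f g p₁ p₂ =
    (f ∘ p₁ ≡ g ∘ p₂) ×
    (∀ {Q} (q₁ : Hom Q X) (q₂ : Hom Q Y) → f ∘ q₁ ≡ g ∘ q₂ →
       Σ (Hom Q P) λ u → ((p₁ ∘ u ≡ q₁) × (p₂ ∘ u ≡ q₂)) ×
         (∀ (v : Hom Q P) → p₁ ∘ v ≡ q₁ → p₂ ∘ v ≡ q₂ → v ≡ u))

  IsTerminal : Obj → Set (o ⊔ ℓ)
  IsTerminal T = ∀ X → Σ (Hom X T) λ u → ∀ (v : Hom X T) → v ≡ u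

  IsProduct : ∀ {A B P} → Hom P A → Hom P B → Set (o ⊔ ℓ)
  IsProduct {A} {B} {P} π₁ π₂ =
    ∀ {X} (f : Hom X A) (g : Hom X B) →
      Σ (Hom X P) λ u → ((π₁ ∘ u ≡ f) × (π₂ ∘ u ≡ g)) ×
        (∀ (v : Hom X P) → π₁ ∘ v ≡ f → π₂ ∘ v ≡ g → v ≡ u)

  IsFPBC : ∀ {I L G F} (α : Hom I L) (m : Hom L G) (γ : Hom I F) (β : Hom F G) →
           Set (o ⊔ ℓ)
  IsFPBC {I} {L} {G} {F} α m γ β =
    IsPullback m β α γ ×
    (∀ {I' F'} (α' : Hom I' L) (γ' : Hom I' F') (β' : Hom F' G) →
       IsPullback m β' α' γ' →
       ∀ (f : Hom I' I) → α ∘ f ≡ α' →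
       Σ (Hom F' F) λ f' → ((β ∘ f' ≡ β') × (γ ∘ f ≡ f' ∘ γ')) ×
         (∀ (g : Hom F' F) → β ∘ g ≡ β' → γ ∘ f ≡ g ∘ γ' → g ≡ f'))

  record MatObj {L A : Obj} (φ : Hom L A) : Set (o ⊔ ℓ) where
    constructor matObj
    field
      X      : Obj
      m      : Hom L X
      ψ      : Hom X A
      m-mono : Mono m
      factor : ψ ∘ m ≡ φ

  MatHom : ∀ {L A} {φ : Hom L A} → MatObj φ → MatObj φ → Set (o ⊔ ℓ)
  MatHom (matObj X m ψ _ _) (matObj Y m' ψ' _ _) =
    Σ (Hom X Y) λ f → (ψ' ∘ f ≡ ψ) × IsPullback f m' m id

  -- terminal object of Mat(φ); arrows of Mat(φ) are equal iff their
  -- underlying arrows of C are equal.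
  IsTerminalMat : ∀ {L A} {φ : Hom L A} → MatObj φ → Set (o ⊔ ℓ)
  IsTerminalMat {φ = φ} T =
    ∀ (Y : MatObj φ) → Σ (MatHom Y T) λ u →
      ∀ (v : MatHom Y T) → proj₁ v ≡ proj₁ u

record Topos (o ℓ : Level) : Set (suc (o ⊔ ℓ)) where
  field
    cat : Category o ℓ
  open Category cat
  field
    𝟏         : Obj
    𝟏-terminal : IsTerminal cat 𝟏
    _×ₒ_      : Obj → Obj → Obj
    π₁        : ∀ {A B} → Hom (A ×ₒ B) A
    π₂        : ∀ {A B} → Hom (A ×ₒ B) B
    product   : ∀ {A B} → IsProduct cat (π₁ {A} {B}) (π₂ {A} {B})
    pullback  : ∀ {X Y Z} (f : Hom X Z) (g : Hom Y Z) →
                Σ Obj λ P → Σ (Hom P X) λ p₁ → Σ (Hom P Y) λ p₂ →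
                  IsPullback cat f g p₁ p₂
  ! : ∀ {A} → Hom A 𝟏
  ! {A} = proj₁ (𝟏-terminal A)
  ⟨_,_⟩ : ∀ {X A B} → Hom X A → Hom X B → Hom X (A ×ₒ B)
  ⟨ f , g ⟩ = proj₁ (product f g)
  field
    _^_       : Obj → Obj → Obj
    eval      : ∀ {B A} → Hom ((B ^ A) ×ₒ A) B
    curry     : ∀ {X A B} → Hom (X ×ₒ A) B → Hom X (B ^ A)
    eval-curry : ∀ {X A B} (f : Hom (X ×ₒ A) B) →
                 eval ∘ ⟨ curry f ∘ π₁ , π₂ ⟩ ≡ f
    curry-unique : ∀ {X A B} (f : Hom (X ×ₒ A) B) (h : Hom X (B ^ A)) →
                   eval ∘ ⟨ h ∘ π₁ , π₂ ⟩ ≡ f → h ≡ curry f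
    Ω         : Obj
    true      : Hom 𝟏 Ω
    classify  : ∀ {S X} (m : Hom S X) → Mono cat m →
                Σ (Hom X Ω) λ χ → IsPullback cat χ true m ! ×
                  (∀ (χ' : Hom X Ω) → IsPullback cat χ' true m ! → χ' ≡ χ)
  true[_] : ∀ A → Hom A (A ×ₒ Ω)
  true[ A ] = ⟨ id , true ∘ ! ⟩

-- The theorem then follows: η is mono as a pullback of the split mono true_A;
-- for an object (X, m, ψ) of Mat(φ) the arrow ⟨ψ, χ_m⟩ gives a pullback
-- square over true_A, so the FPBC property yields the arrow u : X → Φ̄, whose
-- square over η is a pullback by the converse pasting lemma; and every other
-- arrow v of Mat(φ) pastes to a pullback over true_A, hence χ ∘ v = ⟨ψ, χ_m⟩
-- by uniqueness of classifying maps, hence v = u by the FPBC uniqueness.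
module Submission where

open import Level using (Level)
open import Data.Product using (Σ; _×_; _,_; proj₁; proj₂)
open import Relation.Binary.PropositionalEquality
  using (_≡_; refl; sym; trans; cong; subst; subst₂; module ≡-Reasoning)
open import Defs

module PullbackLemmas {o ℓ : Level} (C : Category o ℓ) where
  open Category C
  open ≡-Reasoning

  extend : ∀ {A B B' D E} {f : Hom B D} {g : Hom A B} {h : Hom B' D} {k : Hom A B'}
           (x : Hom E A) → f ∘ g ≡ h ∘ k → f ∘ (g ∘ x) ≡ h ∘ (k ∘ x)
  extend x e = trans (sym assoc) (trans (cong (_∘ x) e) assoc)

  retraction⇒mono : ∀ {A B} {s : Hom A B} (r : Hom B A) → r ∘ s ≡ id → Mono C s
  retraction⇒mono {s = s} r rs g h e = begin
    g             ≡⟨ sym identityˡ ⟩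
    id ∘ g        ≡⟨ cong (_∘ g) (sym rs) ⟩
    (r ∘ s) ∘ g   ≡⟨ assoc ⟩
    r ∘ (s ∘ g)   ≡⟨ cong (r ∘_) e ⟩
    r ∘ (s ∘ h)   ≡⟨ sym assoc ⟩
    (r ∘ s) ∘ h   ≡⟨ cong (_∘ h) rs ⟩
    id ∘ h        ≡⟨ identityˡ ⟩
    h             ∎

  pullback-jointly-monic : ∀ {P X Y Z Q} {f : Hom X Z} {g : Hom Y Z}
    {p₁ : Hom P X} {p₂ : Hom P Y} → IsPullback C f g p₁ p₂ →
    (a b : Hom Q P) → p₁ ∘ a ≡ p₁ ∘ b → p₂ ∘ a ≡ p₂ ∘ b → a ≡ b
  pullback-jointly-monic (sq , univ) a b e₁ e₂ with univ _ _ (extend b sq)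
  ... | _ , _ , unique = trans (unique a e₁ e₂) (sym (unique b refl refl))

  pullback-of-mono : ∀ {P X Y Z} {f : Hom X Z} {g : Hom Y Z}
    {p₁ : Hom P X} {p₂ : Hom P Y} → Mono C f → IsPullback C f g p₁ p₂ → Mono C p₂
  pullback-of-mono {f = f} {g} {p₁} {p₂} f-mono pb a b e =
    pullback-jointly-monic pb a b (f-mono (p₁ ∘ a) (p₁ ∘ b) f-agrees) e
    where
    f-agrees : f ∘ (p₁ ∘ a) ≡ f ∘ (p₁ ∘ b)
    f-agrees = begin
      f ∘ (p₁ ∘ a) ≡⟨ extend a (proj₁ pb) ⟩
      g ∘ (p₂ ∘ a) ≡⟨ cong (g ∘_) e ⟩
      g ∘ (p₂ ∘ b) ≡⟨ sym (extend b (proj₁ pb)) ⟩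
      f ∘ (p₁ ∘ b) ∎

  pasting : ∀ {P X Y Z R W} {f : Hom X Z} {g : Hom Y Z} {p₁ : Hom P X}
    {p₂ : Hom P Y} {h : Hom W Y} {r₁ : Hom R W} {r₂ : Hom R P} →
    IsPullback C f g p₁ p₂ → IsPullback C h p₂ r₁ r₂ →
    IsPullback C f (g ∘ h) (p₁ ∘ r₂) r₁
  pasting {X = X} {R = R} {W = W} {f = f} {g} {p₁} {p₂} {h} {r₁} {r₂}
          (sq , univ) (sq' , univ') = outer , mediate
    where
    outer : f ∘ (p₁ ∘ r₂) ≡ (g ∘ h) ∘ r₁
    outer = begin
      f ∘ (p₁ ∘ r₂) ≡⟨ extend r₂ sq ⟩
      g ∘ (p₂ ∘ r₂) ≡⟨ cong (g ∘_) (sym sq') ⟩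
      g ∘ (h ∘ r₁)  ≡⟨ sym assoc ⟩
      (g ∘ h) ∘ r₁  ∎
    mediate : ∀ {Q} (q₁ : Hom Q X) (q₂ : Hom Q W) → f ∘ q₁ ≡ (g ∘ h) ∘ q₂ →
      Σ (Hom Q R) λ b → (((p₁ ∘ r₂) ∘ b ≡ q₁) × (r₁ ∘ b ≡ q₂)) ×
        (∀ v → (p₁ ∘ r₂) ∘ v ≡ q₁ → r₁ ∘ v ≡ q₂ → v ≡ b)
    mediate q₁ q₂ e with univ q₁ (h ∘ q₂) (trans e assoc)
    ... | a , (p₁a , p₂a) , a-unique with univ' q₂ a (sym p₂a)
    ... | b , (r₁b , r₂b) , b-unique =
      b , (trans assoc (trans (cong (p₁ ∘_) r₂b) p₁a) , r₁b) , unique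
      where
      -- r₂ ∘ v mediates the right-hand pullback, so it is a.
      unique : ∀ v → (p₁ ∘ r₂) ∘ v ≡ q₁ → r₁ ∘ v ≡ q₂ → v ≡ b
      unique v e₁ e₂ = b-unique v e₂ (a-unique (r₂ ∘ v) (trans (sym assoc) e₁)
        (trans (sym (extend v sq')) (cong (h ∘_) e₂)))

  pasting⁻¹ : ∀ {P X Y Z R W} {f : Hom X Z} {g : Hom Y Z} {p₁ : Hom P X}
    {p₂ : Hom P Y} {h : Hom W Y} {r₁ : Hom R W} {r₂ : Hom R P} →
    IsPullback C f g p₁ p₂ → h ∘ r₁ ≡ p₂ ∘ r₂ →
    IsPullback C f (g ∘ h) (p₁ ∘ r₂) r₁ → IsPullback C h p₂ r₁ r₂
  pasting⁻¹ {P = P} {R = R} {W = W} {f = f} {g} {p₁} {p₂} {h} {r₁} {r₂}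
            right sq' (_ , univ) = sq' , mediate
    where
    mediate : ∀ {Q} (q₁ : Hom Q W) (q₂ : Hom Q P) → h ∘ q₁ ≡ p₂ ∘ q₂ →
      Σ (Hom Q R) λ b → ((r₁ ∘ b ≡ q₁) × (r₂ ∘ b ≡ q₂)) ×
        (∀ v → r₁ ∘ v ≡ q₁ → r₂ ∘ v ≡ q₂ → v ≡ b)
    mediate {Q} q₁ q₂ e = mediate'
      where
      outer-cone : f ∘ (p₁ ∘ q₂) ≡ (g ∘ h) ∘ q₁
      outer-cone = begin
        f ∘ (p₁ ∘ q₂) ≡⟨ extend q₂ (proj₁ right) ⟩
        g ∘ (p₂ ∘ q₂) ≡⟨ cong (g ∘_) (sym e) ⟩
        g ∘ (h ∘ q₁)  ≡⟨ sym assoc ⟩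
        (g ∘ h) ∘ q₁  ∎
      mediate' : Σ (Hom Q R) λ b → ((r₁ ∘ b ≡ q₁) × (r₂ ∘ b ≡ q₂)) ×
        (∀ v → r₁ ∘ v ≡ q₁ → r₂ ∘ v ≡ q₂ → v ≡ b)
      mediate' with univ (p₁ ∘ q₂) q₁ outer-cone
      ... | b , (p₁r₂b , r₁b) , b-unique = b , (r₁b , r₂b) , unique
        where
        -- r₂ ∘ b and q₂ agree on both legs of the right-hand pullback.
        r₂b : r₂ ∘ b ≡ q₂
        r₂b = pullback-jointly-monic right (r₂ ∘ b) q₂ (trans (sym assoc) p₁r₂b)
          (trans (sym (extend b sq')) (trans (cong (h ∘_) r₁b) e))
        unique : ∀ v → r₁ ∘ v ≡ q₁ → r₂ ∘ v ≡ q₂ → v ≡ b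
        unique v e₁ e₂ = b-unique v (trans assoc (cong (p₁ ∘_) e₂)) e₁

module SliceClassifier {o ℓ : Level} (𝓔 : Topos o ℓ) where
  open Topos 𝓔
  open Category cat
  open PullbackLemmas cat
  open ≡-Reasoning

  !-unique : ∀ {X} (f g : Hom X 𝟏) → f ≡ g
  !-unique {X} f g = trans (proj₂ (𝟏-terminal X) f) (sym (proj₂ (𝟏-terminal X) g))

  π₁-pair : ∀ {X A B} (f : Hom X A) (g : Hom X B) → π₁ ∘ ⟨ f , g ⟩ ≡ f
  π₁-pair f g = proj₁ (proj₁ (proj₂ (product f g)))

  π₂-pair : ∀ {X A B} (f : Hom X A) (g : Hom X B) → π₂ ∘ ⟨ f , g ⟩ ≡ g
  π₂-pair f g = proj₂ (proj₁ (proj₂ (product f g)))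

  pair-ext : ∀ {X A B} {a b : Hom X (A ×ₒ B)} →
    π₁ ∘ a ≡ π₁ ∘ b → π₂ ∘ a ≡ π₂ ∘ b → a ≡ b
  pair-ext {a = a} {b} e₁ e₂ = trans (unique a e₁ e₂) (sym (unique b refl refl))
    where unique = proj₂ (proj₂ (product (π₁ ∘ b) (π₂ ∘ b)))

  π₁-true : ∀ {A Y} (h : Hom Y A) → π₁ ∘ (true[ A ] ∘ h) ≡ h
  π₁-true h = trans (sym assoc) (trans (cong (_∘ h) (π₁-pair id (true ∘ !))) identityˡ)

  π₂-true : ∀ {A Y} (h : Hom Y A) → π₂ ∘ (true[ A ] ∘ h) ≡ true ∘ !
  π₂-true h = trans (sym assoc) (trans (cong (_∘ h) (π₂-pair id (true ∘ !)))
    (trans assoc (cong (true ∘_) (!-unique _ _))))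

  true[]-mono : ∀ A → Mono cat true[ A ]
  true[]-mono A = retraction⇒mono π₁ (π₁-pair id (true ∘ !))

  char : ∀ {S X} (m : Hom S X) → Mono cat m → Hom X Ω
  char m m-mono = proj₁ (classify m m-mono)

  char-pullback : ∀ {S X} (m : Hom S X) (m-mono : Mono cat m) →
    IsPullback cat (char m m-mono) true m !
  char-pullback m m-mono = proj₁ (proj₂ (classify m m-mono))

  char-unique : ∀ {S X} (m : Hom S X) (m-mono : Mono cat m) (χ' : Hom X Ω) →
    IsPullback cat χ' true m ! → χ' ≡ char m m-mono
  char-unique m m-mono = proj₂ (proj₂ (classify m m-mono))

  slice-pullback-from : ∀ {S X A} (β : Hom X (A ×ₒ Ω)) (m : Hom S X) (φ : Hom S A) →
    (π₁ ∘ β) ∘ m ≡ φ → IsPullback cat (π₂ ∘ β) true m ! →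
    IsPullback cat true[ A ] β φ m
  slice-pullback-from {S} {X} {A} β m φ fac (sq , univ) = square , mediate
    where
    square : true[ A ] ∘ φ ≡ β ∘ m
    square = pair-ext
      (trans (π₁-true φ) (trans (sym fac) assoc))
      (trans (π₂-true φ) (trans (sym sq) assoc))
    mediate : ∀ {Q} (q₁ : Hom Q A) (q₂ : Hom Q X) → true[ A ] ∘ q₁ ≡ β ∘ q₂ →
      Σ (Hom Q S) λ w → ((φ ∘ w ≡ q₁) × (m ∘ w ≡ q₂)) ×
        (∀ v → φ ∘ v ≡ q₁ → m ∘ v ≡ q₂ → v ≡ w)
    mediate q₁ q₂ e with univ q₂ ! (trans assoc (trans (cong (π₂ ∘_) (sym e)) (π₂-true q₁)))
    ... | w , (mw , _) , w-unique = w , (φw , mw) , λ v _ mv → w-unique v mv (!-unique _ _)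
      where
      φw : φ ∘ w ≡ q₁
      φw = begin
        φ ∘ w                 ≡⟨ cong (_∘ w) (sym fac) ⟩
        ((π₁ ∘ β) ∘ m) ∘ w    ≡⟨ trans assoc assoc ⟩
        π₁ ∘ (β ∘ (m ∘ w))    ≡⟨ cong (λ k → π₁ ∘ (β ∘ k)) mw ⟩
        π₁ ∘ (β ∘ q₂)         ≡⟨ cong (π₁ ∘_) (sym e) ⟩
        π₁ ∘ (true[ A ] ∘ q₁) ≡⟨ π₁-true q₁ ⟩
        q₁                    ∎

  slice-pullback-to : ∀ {S X A} {β : Hom X (A ×ₒ Ω)} {m : Hom S X} {φ : Hom S A} →
    IsPullback cat true[ A ] β φ m → IsPullback cat (π₂ ∘ β) true m !
  slice-pullback-to {S} {X} {A} {β} {m} {φ} (sq , univ) = square , mediate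
    where
    square : (π₂ ∘ β) ∘ m ≡ true ∘ !
    square = trans assoc (trans (cong (π₂ ∘_) (sym sq)) (π₂-true φ))
    lifted : ∀ {Q} (q₁ : Hom Q X) (q₂ : Hom Q 𝟏) → (π₂ ∘ β) ∘ q₁ ≡ true ∘ q₂ →
      true[ A ] ∘ (π₁ ∘ (β ∘ q₁)) ≡ β ∘ q₁
    lifted q₁ q₂ e = pair-ext (π₁-true _)
      (trans (π₂-true _) (trans (cong (true ∘_) (!-unique ! q₂)) (trans (sym e) assoc)))
    mediate : ∀ {Q} (q₁ : Hom Q X) (q₂ : Hom Q 𝟏) → (π₂ ∘ β) ∘ q₁ ≡ true ∘ q₂ →
      Σ (Hom Q S) λ w → ((m ∘ w ≡ q₁) × (! ∘ w ≡ q₂)) ×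
        (∀ v → m ∘ v ≡ q₁ → ! ∘ v ≡ q₂ → v ≡ w)
    mediate q₁ q₂ e with univ (π₁ ∘ (β ∘ q₁)) q₁ (lifted q₁ q₂ e)
    ... | w , (_ , mw) , w-unique = w , (mw , !-unique _ _) , λ v mv _ → w-unique v (φv v mv) mv
      where
      φv : ∀ v → m ∘ v ≡ q₁ → φ ∘ v ≡ π₁ ∘ (β ∘ q₁)
      φv v mv = begin
        φ ∘ v                      ≡⟨ cong (_∘ v) (sym (π₁-true φ)) ⟩
        (π₁ ∘ (true[ A ] ∘ φ)) ∘ v ≡⟨ cong (λ k → (π₁ ∘ k) ∘ v) sq ⟩
        (π₁ ∘ (β ∘ m)) ∘ v         ≡⟨ trans assoc (cong (π₁ ∘_) assoc) ⟩
        π₁ ∘ (β ∘ (m ∘ v))         ≡⟨ cong (λ k → π₁ ∘ (β ∘ k)) mv ⟩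
        π₁ ∘ (β ∘ q₁)              ∎

module Materialization {o ℓ : Level} (𝓔 : Topos o ℓ) where
  open Topos 𝓔
  open Category cat
  open PullbackLemmas cat
  open SliceClassifier 𝓔

  module FinalComplement {L A : Obj} (φ : Hom L A) (Φ̄ : Obj) (η : Hom L Φ̄)
    (χ : Hom Φ̄ (A ×ₒ Ω)) (fpbc : IsFPBC cat φ true[ A ] η χ) where

    complement-pullback : IsPullback cat true[ A ] χ φ η
    complement-pullback = proj₁ fpbc

    η-mono : Mono cat η
    η-mono = pullback-of-mono (true[]-mono A) complement-pullback

    factorization : (π₁ ∘ χ) ∘ η ≡ φ
    factorization =
      trans assoc (trans (cong (π₁ ∘_) (sym (proj₁ complement-pullback))) (π₁-true φ))

    Φ̄-obj : MatObj cat φ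
    Φ̄-obj = matObj Φ̄ η (π₁ ∘ χ) η-mono factorization

    module Comparison (Y : MatObj cat φ) where
      open MatObj Y

      β : Hom X (A ×ₒ Ω)
      β = ⟨ ψ , char m m-mono ⟩

      β-pullback : IsPullback cat true[ A ] β φ m
      β-pullback = slice-pullback-from β m φ
        (trans (cong (_∘ m) (π₁-pair ψ _)) factor)
        (subst (λ k → IsPullback cat k true m !) (sym (π₂-pair ψ _))
               (char-pullback m m-mono))

      comparison : Σ (Hom X Φ̄) λ u → ((χ ∘ u ≡ β) × (η ∘ id ≡ u ∘ m)) ×
        (∀ g → χ ∘ g ≡ β → η ∘ id ≡ g ∘ m → g ≡ u)
      comparison = proj₂ fpbc φ m β β-pullback id identityʳ

      u : Hom X Φ̄
      u = proj₁ comparison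

      χu≡β : χ ∘ u ≡ β
      χu≡β = proj₁ (proj₁ (proj₂ comparison))

      -- The square u ∘ m = η ∘ id is a pullback, since pasting it to the
      -- FPBC square gives the pullback square of β.
      u-pullback : IsPullback cat u η m id
      u-pullback = pasting⁻¹ complement-pullback (sym (proj₂ (proj₁ (proj₂ comparison))))
        (subst₂ (λ g p → IsPullback cat true[ A ] g p m) (sym χu≡β) (sym identityʳ)
                β-pullback)

      to-Φ̄ : MatHom cat Y Φ̄-obj
      to-Φ̄ = u , trans assoc (trans (cong (π₁ ∘_) χu≡β) (π₁-pair ψ _)) , u-pullback

      -- Any arrow v of Mat(φ) into Φ̄ satisfies χ ∘ v = β: its first component
      -- is ψ, and its second classifies m because the pasted square is a
      -- pullback over true_A.
      to-Φ̄-unique : (v : MatHom cat Y Φ̄-obj) → proj₁ v ≡ u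
      to-Φ̄-unique (v , ψ-eq , v-pullback) =
        proj₂ (proj₂ comparison) v χv≡β (sym (proj₁ v-pullback))
        where
        pasted : IsPullback cat true[ A ] (χ ∘ v) φ m
        pasted = subst (λ p → IsPullback cat true[ A ] (χ ∘ v) p m) identityʳ
                       (pasting complement-pullback v-pullback)
        χv≡β : χ ∘ v ≡ β
        χv≡β = pair-ext
          (trans (sym assoc) (trans ψ-eq (sym (π₁-pair ψ _))))
          (trans (char-unique m m-mono _ (slice-pullback-to pasted))
                 (sym (π₂-pair ψ _)))

corollary9 : ∀ {o ℓ : Level} (𝓔 : Topos o ℓ) →
    let open Topos 𝓔 in let open Category cat in
    ∀ {L A : Obj} (φ : Hom L A)
      (Φ̄ : Obj) (η : Hom L Φ̄) (χ : Hom Φ̄ (A ×ₒ Ω)) →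
      IsFPBC cat φ true[ A ] η χ →
      Σ (Mono cat η) λ η-mono →
        Σ ((π₁ ∘ χ) ∘ η ≡ φ) λ fac →
          IsTerminalMat cat (matObj Φ̄ η (π₁ ∘ χ) η-mono fac)
corollary9 𝓔 φ Φ̄ η χ fpbc =
  η-mono , factorization , λ Y → Comparison.to-Φ̄ Y , Comparison.to-Φ̄-unique Y
  where open Materialization.FinalComplement 𝓔 φ Φ̄ η χ fpbc
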